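{- Let $S$ be a solid and let $x\in S$ with $x\ne e(x)$. Then $e(x)<x$ if and only if $e(x^{ -1})<x^{ -1}$.
   Context: A solid is a set $S$ with binary operations $+$ and $\cdot$ and a relation $\le$ satisfying: (1) $+$ is associative and commutative; for every $x$ there is a unique $e$ with $x+e=x$ and $e+f=e$ whenever $x+f=x$, written $e(x)$ (the magnitude of $x$); for every $x$ there is $s$ with $x+s=e(x)$ and $e(s)=e(x)$, written $-x$; $e(x+y)=e(x)$ or $e(x+y)=e(y)$. (2) $\cdot$ is associative and commutative; for every $x\ne e(x)$ there is a unique $u$ with $xu=x$ and $uv=u$ whenever $xv=x$, written $u(x)$; for every $x\ne e(x)$ there is $d$ with $xd=u(x)$ and $u(d)=u(x)$, written $x^{ -1}$; for $x\ne e(x),y\ne e(y)$: $u(xy)=u(x)$ or $u(xy)=u(y)$. (3) $\le$ is a total order; $x\le y\Rightarrow x+z\le y+z$; $y+e(x)=e(x)\Rightarrow (y\le e(x)$ and $-y\le e(x))$; $(e(x)<x$ and $y\le z)\Rightarrow xy\le xz$; $e(y)\le y\le z\Rightarrow e(x)y\le e(x)z$. (4) For all $x,y$ there is $z$ with $e(x)y=e(z)$; $e(xy)=e(x)y+e(y)x$; for $x\ne e(x)$, $e(u(x))=e(x)x^{ -1}$; $xy+xz=x(y+z)+e(x)y+e(x)z$; $-(xy)=(-x)y$. (5) There is $0$ with $0+x=x$ for all $x$; there is $1$ with $1x=x$ for all $x$; there is $M$ with $e(x)+M=M$ for all $x$; there is $x$ with $e(x)\ne 0$ and $e(x)\ne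 M$; for every $x$ there is $a$ with $x=a+e(x)$ and $e(a)=0$; if $x=e(x)$, $y=e(y)$ and $x<y$ then there is $z\ne e(z)$ with $x<z<y$. -}

module Defs where

open import Level using (Level; suc)
open import Data.Product using (Σ; _×_; _,_)
open import Data.Sum using (_⊎_)
open import Relation.Binary.PropositionalEquality using (_≡_; _≢_)
open import Relation.Binary.Structures using (IsTotalOrder)

Strict : ∀ {a} {A : Set a} → (A → A → Set a) → A → A → Set a
Strict _≤_ x y = x ≤ y × x ≢ y

-- The operations e, -, u, ⁻¹ that the
-- paper introduces by "there is (a unique) ..." are given as fields together
-- with their defining properties; u and ⁻¹ are only constrained on x ≠ e(x).
record Solid (ℓ : Level) : Set (suc ℓ) where
  infixl 6 _+_
  infixl 7 _*_
  infix 4 _≤_ _<_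
  field
    S    : Set ℓ
    _+_  : S → S → S
    _*_  : S → S → S
    _≤_  : S → S → Set ℓ
    e    : S → S
    neg  : S → S
    u    : S → S
    inv  : S → S
    𝟘 𝟙 M : S

  _<_ : S → S → Set ℓ
  _<_ = Strict _≤_

  field
    +-assoc  : ∀ x y z → (x + y) + z ≡ x + (y + z)
    +-comm   : ∀ x y → x + y ≡ y + x
    e-neutral : ∀ x → x + e x ≡ x
    e-minimal : ∀ x f → x + f ≡ x → e x + f ≡ e x
    e-unique  : ∀ x e′ → x + e′ ≡ x → (∀ f → x + f ≡ x → e′ + f ≡ e′) → e′ ≡ e x
    neg-inv   : ∀ x → x + neg x ≡ e x
    neg-mag   : ∀ x → e (neg x) ≡ e x
    e-sum     : ∀ x y → e (x + y) ≡ e x ⊎ e (x + y) ≡ e y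
    *-assoc  : ∀ x y z → (x * y) * z ≡ x * (y * z)
    *-comm   : ∀ x y → x * y ≡ y * x
    u-neutral : ∀ x → x ≢ e x → x * u x ≡ x
    u-minimal : ∀ x v → x ≢ e x → x * v ≡ x → u x * v ≡ u x
    u-unique  : ∀ x u′ → x ≢ e x → x * u′ ≡ x → (∀ v → x * v ≡ x → u′ * v ≡ u′) → u′ ≡ u x
    inv-inv   : ∀ x → x ≢ e x → x * inv x ≡ u x
    inv-unit  : ∀ x → x ≢ e x → u (inv x) ≡ u x
    u-prod    : ∀ x y → x ≢ e x → y ≢ e y → u (x * y) ≡ u x ⊎ u (x * y) ≡ u y
    ≤-isTotalOrder : IsTotalOrder _≡_ _≤_
    ≤-+      : ∀ x y z → x ≤ y → x + z ≤ y + z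
    ≤-absorb : ∀ x y → y + e x ≡ e x → (y ≤ e x × neg y ≤ e x)
    ≤-*pos   : ∀ x y z → e x < x → y ≤ z → x * y ≤ x * z
    ≤-*mag   : ∀ x y z → e y ≤ y → y ≤ z → e x * y ≤ e x * z
    e*-mag   : ∀ x y → Σ S (λ z → e x * y ≡ e z)
    e-prod   : ∀ x y → e (x * y) ≡ e x * y + e y * x
    e-u      : ∀ x → x ≢ e x → e (u x) ≡ e x * inv x
    distrib  : ∀ x y z → x * y + x * z ≡ x * (y + z) + e x * y + e x * z
    neg-*    : ∀ x y → neg (x * y) ≡ neg x * y
    𝟘-id     : ∀ x → 𝟘 + x ≡ x
    𝟙-id     : ∀ x → 𝟙 * x ≡ x
    M-max    : ∀ x → e x + M ≡ M
    nontriv  : Σ S (λ x → e x ≢ 𝟘 × e x ≢ M)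
    decomp   : ∀ x → Σ S (λ a → x ≡ a + e x × e a ≡ 𝟘)
    dense    : ∀ x y → x ≡ e x → y ≡ e y → x < y →
               Σ S (λ z → z ≢ e z × x < z × z < y)

-- Call y positive when e(y) < y.  For positive a the product a·b is at most
-- a·e(b) = e(b)·a, and e(b)·a is absorbed by e(a·b) = e(a)·b + e(b)·a, so a
-- positive factor cannot make a nonpositive one positive.  Hence a positive a
-- forces b to be positive whenever a·b is.  Applied to a·u(a) = a this makes
-- u(x) positive, and since x·x⁻¹ = u(x) = u(x⁻¹), positivity passes from
-- either of x, x⁻¹ to the other.
module Submission where

open import Defs
open import Relation.Binary.PropositionalEquality
  using (_≡_; _≢_; sym; trans; cong; subst; module ≡-Reasoning)
open import Relation.Binary.Bundles using (Preorder)
open import Relation.Binary.Structures using (IsTotalOrder)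
open import Relation.Nullary using (¬_; contradiction)
open import Data.Product using (_,_; proj₁; proj₂)
open import Data.Sum using (inj₁; inj₂)
open import Function.Bundles using (_⇔_; mk⇔)
import Relation.Binary.Reasoning.Preorder as PreorderReasoning

module SolidPositivity {ℓ} (Sol : Solid ℓ) where
  open Solid Sol
  module ≤ = IsTotalOrder ≤-isTotalOrder

  ≤-preorder : Preorder ℓ ℓ ℓ
  ≤-preorder = record { isPreorder = ≤.isPreorder }

  Positive : S → Set ℓ
  Positive y = e y < y

  NonPositive : S → Set ℓ
  NonPositive y = y ≤ e y

  ¬nonPositive⇒positive : ∀ {y} → ¬ NonPositive y → Positive y
  ¬nonPositive⇒positive {y} ¬y≤ey with ≤.total y (e y)
  ... | inj₁ y≤ey = contradiction y≤ey ¬y≤ey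
  ... | inj₂ ey≤y = ey≤y , λ ey≡y → ¬y≤ey (≤.reflexive (sym ey≡y))

  positive⇒¬nonPositive : ∀ {y} → Positive y → ¬ NonPositive y
  positive⇒¬nonPositive (ey≤y , ey≢y) y≤ey = ey≢y (≤.antisym ey≤y y≤ey)

  e-idem : ∀ z → e z + e z ≡ e z
  e-idem z = e-minimal z (e z) (e-neutral z)

  e-absorbs-summand : ∀ m p z → m ≡ p + e z → e z + m ≡ m
  e-absorbs-summand m p z m≡p+ez = begin
    e z + m              ≡⟨ cong (e z +_) m≡p+ez ⟩
    e z + (p + e z)      ≡⟨ cong (e z +_) (+-comm p (e z)) ⟩
    e z + (e z + p)      ≡⟨ sym (+-assoc (e z) (e z) p) ⟩
    (e z + e z) + p      ≡⟨ cong (_+ p) (e-idem z) ⟩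
    e z + p              ≡⟨ +-comm (e z) p ⟩
    p + e z              ≡⟨ sym m≡p+ez ⟩
    m                    ∎
    where open ≡-Reasoning

  e*≤e-* : ∀ a b → e b * a ≤ e (a * b)
  e*≤e-* a b with e*-mag b a
  ... | z , eb*a≡ez = proj₁ (≤-absorb (a * b) (e b * a) absorbed)
    where
    absorbed : e b * a + e (a * b) ≡ e (a * b)
    absorbed = subst (λ q → q + e (a * b) ≡ e (a * b)) (sym eb*a≡ez)
      (e-absorbs-summand (e (a * b)) (e a * b) z
        (trans (e-prod a b) (cong (e a * b +_) eb*a≡ez)))

  positive-*-nonPositive : ∀ {a b} → Positive a → NonPositive b → NonPositive (a * b)
  positive-*-nonPositive {a} {b} a>0 b≤eb = begin
    a * b     ≲⟨ ≤-*pos a b (e b) a>0 b≤eb ⟩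
    a * e b   ≡⟨ *-comm a (e b) ⟩
    e b * a   ≲⟨ e*≤e-* a b ⟩
    e (a * b) ∎
    where open PreorderReasoning ≤-preorder

  positive-factor : ∀ {a b} → Positive a → Positive (a * b) → Positive b
  positive-factor a>0 ab>0 = ¬nonPositive⇒positive λ b≤eb →
    positive⇒¬nonPositive ab>0 (positive-*-nonPositive a>0 b≤eb)

  positive⇒u-positive : ∀ {x} → Positive x → Positive (u x)
  positive⇒u-positive {x} x>0 = positive-factor x>0
    (subst Positive (sym (u-neutral x (λ x≡ex → proj₂ x>0 (sym x≡ex)))) x>0)

proposition2p24 : ∀ {ℓ} (Sol : Solid ℓ) → let open Solid Sol in
    ∀ (x : S) → x ≢ e x → (e x < x ⇔ e (inv x) < inv x)
proposition2p24 Sol x x≢ex = mk⇔ forward backward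
  where
  open Solid Sol
  open SolidPositivity Sol

  x*x⁻¹-positive : Positive (u x) → Positive (x * inv x)
  x*x⁻¹-positive = subst Positive (sym (inv-inv x x≢ex))

  forward : Positive x → Positive (inv x)
  forward x>0 = positive-factor x>0 (x*x⁻¹-positive (positive⇒u-positive x>0))

  backward : Positive (inv x) → Positive x
  backward x⁻¹>0 = positive-factor x⁻¹>0
    (subst Positive (*-comm x (inv x)) (x*x⁻¹-positive ux>0))
    where
    ux>0 : Positive (u x)
    ux>0 = subst Positive (inv-unit x x≢ex) (positive⇒u-positive x⁻¹>0)
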